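{- Let $G=(V,E)$ be a connected hypergraph with $n=|V|$ and $\texttt{opt}(G)\ge80\log^2 n$, let $e_1,\dots,e_m$ be any ordering of $E$, and let $G_{\mathsf{good}}=(V,E_{\mathsf{good}})$ be the subhypergraph of good hyperedges (defined in the context). Then (1) $G_{\mathsf{good}}$ is connected, and (2) $\lambda(G_{\mathsf{good}})\ge\frac12\lambda(G)$.
   Context: A hypergraph $G=(V,E)$ has a multiset $E$ of nonempty subsets of $V$; it is connected if its bipartite incidence graph is connected. A sub-multiset $F\subseteq E$ is a connected spanning subhypergraph if $\bigcup_{e\in F}e=V$ and $(V,F)$ is connected; $\texttt{opt}(G)$ is the maximum number of pairwise disjoint connected spanning subhypergraphs. For $S\subseteq V$, $\delta(S)$ is the set of hyperedges intersecting both $S$ and $V\setminus S$; $\lambda(G)=\min_{\emptyset\ne S\subsetneq V}|\delta(S)|$. Let $E_t=\{e_1,\dots,e_t\}$ and for $S\subseteq V$, $E_t(S)=\{e\in E_t: S\subseteq e\}$. Let $\eta_t=\min_{\{u,v\}\subseteq e_t,\ u\neq v}|E_t(\{u,v\})|$. Hyperedge $e_t$ is good if $\frac{\lambda(G)}{n^2}\le\eta_t\le\lambda(G)$; $E_{\mathsf{good}}$ is the set of good hyperedges. Logarithms are base 2. -}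

module Defs where

open import Data.Nat using (ℕ; zero; suc; _+_; _*_; _^_; _≤_; _<_; _≤ᵇ_; _⊓_)
open import Data.Nat.Properties using (_≤?_)
open import Data.Fin using (Fin; toℕ)
open import Data.Fin.Subset using (Subset; _∈_; _∩_; ∁; ⊤; Nonempty; Empty; inside; outside)
open import Data.Fin.Subset.Properties using (_∈?_; nonempty?)
open import Data.List using (List; []; _∷_; length; filter; allFin; concatMap)
open import Data.Maybe using (Maybe; just; nothing)
open import Data.Bool using (Bool; true; false; _∧_)
open import Data.Product using (Σ; ∃; _×_; _,_)
open import Data.Sum using (_⊎_; inj₁; inj₂)
open import Data.Unit using () renaming (⊤ to ⊤′)
open import Data.Vec using (tabulate)
open import Relation.Nullary using (¬_; does)
open import Relation.Nullary.Decidable using (_×-dec_; ¬?)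
open import Relation.Binary.PropositionalEquality using (_≡_; _≢_)
open import Relation.Binary.Construct.Closure.ReflexiveTransitive using (Star)
open import Data.Fin using (_≟_)

-- A hypergraph on vertex set V = Fin n with m hyperedges, given in a fixed
-- ordering e_0, ..., e_{m-1} (0-based index i corresponds to e_{i+1}).
-- Repeated hyperedges are allowed (multiset).
Hypergraph : ℕ → ℕ → Set
Hypergraph n m = Fin m → Subset n

NonemptyEdges : ∀ {n m} → Hypergraph n m → Set
NonemptyEdges {m = m} E = (i : Fin m) → Nonempty (E i)

-- A sub-multiset F ⊆ E is represented by a subset of the edge indices.

-- Nodes of the bipartite incidence graph of (V, F): vertices and edges of F.
Node : ℕ → ℕ → Set
Node n m = Fin n ⊎ Fin m

IsNode : ∀ {n m} → Subset m → Node n m → Set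
IsNode F (inj₁ v) = ⊤′
IsNode F (inj₂ i) = i ∈ F

Adj : ∀ {n m} → Hypergraph n m → Subset m → Node n m → Node n m → Set
Adj E F (inj₁ v) (inj₁ w) = Data.Empty.⊥
  where import Data.Empty
Adj E F (inj₁ v) (inj₂ i) = i ∈ F × v ∈ E i
Adj E F (inj₂ i) (inj₁ v) = i ∈ F × v ∈ E i
Adj E F (inj₂ i) (inj₂ j) = Data.Empty.⊥
  where import Data.Empty

Connected : ∀ {n m} → Hypergraph n m → Subset m → Set
Connected E F = ∀ x y → IsNode F x → IsNode F y → Star (Adj E F) x y

Spanning : ∀ {n m} → Hypergraph n m → Subset m → Set
Spanning {n} E F = (v : Fin n) → ∃ λ i → i ∈ F × v ∈ E i

ConnectedSpanning : ∀ {n m} → Hypergraph n m → Subset m → Set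
ConnectedSpanning E F = Spanning E F × Connected E F

-- opt(G) ≥ k : there are k pairwise disjoint connected spanning subhypergraphs
-- (opt is the maximum such number, so opt(G) ≥ k iff such a family exists)
HasDisjointCSS : ∀ {n m} → Hypergraph n m → ℕ → Set
HasDisjointCSS {m = m} E k =
  Σ (Fin k → Subset m) λ Fs →
    ((j : Fin k) → ConnectedSpanning E (Fs j)) ×
    ((j j′ : Fin k) → j ≢ j′ → Empty (Fs j ∩ Fs j′))

cutSize : ∀ {n m} → Hypergraph n m → Subset m → Subset n → ℕ
cutSize {m = m} E F S =
  length (filter (λ i → (i ∈? F) ×-dec (nonempty? (E i ∩ S) ×-dec nonempty? (E i ∩ ∁ S)))
                 (allFin m))

IsLambda : ∀ {n m} → Hypergraph n m → Subset m → ℕ → Set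
IsLambda {n} E F L =
  (∃ λ (S : Subset n) → Nonempty S × Nonempty (∁ S) × cutSize E F S ≡ L) ×
  ((S : Subset n) → Nonempty S → Nonempty (∁ S) → L ≤ cutSize E F S)

pairCount : ∀ {n m} → Hypergraph n m → Fin m → Fin n → Fin n → ℕ
pairCount {m = m} E t u v =
  length (filter (λ i → (toℕ i ≤? toℕ t) ×-dec ((u ∈? E i) ×-dec (v ∈? E i))) (allFin m))

-- minimum of a list; nothing for the empty list (minimum over ∅ = +∞)
minimum : List ℕ → Maybe ℕ
minimum [] = nothing
minimum (x ∷ xs) with minimum xs
... | nothing = just x
... | just y  = just (x ⊓ y)

pairsIn : ∀ {n m} → Hypergraph n m → Fin m → List (Fin n × Fin n)
pairsIn {n} E t =
  filter (λ (p : Fin n × Fin n) → let (u , v) = p in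
            ¬? (u ≟ v) ×-dec ((u ∈? E t) ×-dec (v ∈? E t)))
    (concatMap (λ u → Data.List.map (λ v → (u , v)) (allFin n)) (allFin n))

-- η_t = min over {u,v} ⊆ e_t, u ≠ v, of |E_t({u,v})|  (nothing = +∞ if |e_t| = 1)
eta : ∀ {n m} → Hypergraph n m → Fin m → Maybe ℕ
eta E t = minimum (Data.List.map (λ (p : _ × _) → let (u , v) = p in pairCount E t u v) (pairsIn E t))

-- e_t is good (w.r.t. L = λ(G)) iff λ(G)/n² ≤ η_t ≤ λ(G),
-- i.e. L ≤ n² · η_t and η_t ≤ L.
isGood : ∀ {n m} → Hypergraph n m → ℕ → Fin m → Bool
isGood {n} E L t with eta E t
... | nothing = false
... | just η  = (L ≤ᵇ n * n * η) ∧ (η ≤ᵇ L)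

Egood : ∀ {n m} → Hypergraph n m → ℕ → Subset m
Egood E L = tabulate λ t → if isGood E L t then inside else outside
  where open import Data.Bool using (if_then_else_)

-- 80 log₂² n ≤ k, expressed without reals:
-- for all rationals p/q < log₂ n (i.e. 2^p < n^q, q ≥ 1), 80 p² ≤ k q².
-- (Equivalent to 80 (log₂ n)² ≤ k for n ≥ 1, since log₂ n ≥ 0.)
LogSqBound : ℕ → ℕ → Set
LogSqBound n k = (p q : ℕ) → 2 ^ p < n ^ suc q → 80 * (p * p) ≤ k * (suc q * suc q)

-- Fix S with ∅ ≠ S ⊊ V, so |δ(S)| ≥ λ. A hyperedge e_t ∈ δ(S) that is not good is either low
-- (n² η_t < λ) or high (η_t > λ). If e_t contains a ∈ S and c ∉ S, then η_t ≤ |E_t({a,c})|, and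
-- every hyperedge counted there crosses S; so η_t is at most the rank of e_t among the hyperedges
-- of δ(S), a high e_t comes after the λ-th of them, and at most |δ(S)| − λ are high. A low e_t
-- contains u ≠ v such that e_t is among the first ⌊(λ−1)/n²⌋ hyperedges containing both; counting
-- every low hyperedge through both orderings of such a pair, over all n² ordered pairs, shows that
-- fewer than λ/2 hyperedges of G are low. Hence δ(S) contains more than λ/2 good hyperedges, for
-- every S: G_good is connected and λ(G_good) ≥ λ/2.

module Submission where

open import Defs
open import Data.Nat using (ℕ; _*_; _≤_)
open import Data.Fin.Subset using (⊤)
open import Data.Product using (_×_; Σ)

open import Level using (0ℓ)
open import Function using (id; _∘_; Equivalence)
open import Data.Nat
open import Data.Nat.Properties
open import Data.Nat.DivMod using (_/_; m/n*n≤m; /-monoˡ-≤; m*n/n≡m)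
open import Data.Nat.ListAction using (sum)
open import Data.Bool using (true; if_then_else_)
open import Data.Bool.Properties using (T-≡; T-∧)
open import Data.Maybe using (just; nothing)
open import Data.Maybe.Properties using (just-injective)
open import Data.Maybe.Relation.Unary.Any as Maybe using (just)
open import Data.Fin using (Fin; toℕ) renaming (_≟_ to _≟ᶠ_)
open import Data.Fin.Properties using (toℕ-injective)
open import Data.Fin.Subset using (Subset; _∈_; _∉_; _∩_; _∪_; ∁; ⁅_⁆; ∣_∣; Nonempty; inside; outside)
open import Data.Fin.Subset.Properties
  using (_∈?_; nonempty?; ∈⊤; x∈p∩q⁺; x∈p∩q⁻; x∈p∪q⁺; x∈p∪q⁻; x∈∁p⇒x∉p; x∉∁p⇒x∈p; x∉p⇒x∈∁p;
         x∈⁅x⁆; x∈⁅y⁆⇒x≡y; p⊆p∪q; p⊂q⇒∣p∣<∣q∣; ∣p∣≤n)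
open import Data.List using (List; []; _∷_; _++_; length; filter; allFin; map; concatMap; cartesianProduct)
open import Data.List.Properties using (filter-none; length-++; length-map; length-tabulate)
open import Data.List.Membership.Propositional using () renaming (_∈_ to _∈ₗ_)
open import Data.List.Membership.Propositional.Properties
  using (∈-allFin; ∈-filter⁺; ∈-filter⁻; ∈-concatMap⁺; ∈-map⁺; ∈-map⁻; ∈-cartesianProduct⁺)
open import Data.List.Relation.Unary.All as All using (All)
open import Data.List.Relation.Unary.Any as Any using (here; there)
open import Data.List.Relation.Unary.AllPairs using ([]; _∷_)
open import Data.List.Relation.Unary.Unique.Propositional using (Unique)
open import Data.List.Relation.Unary.Unique.Propositional.Properties using (allFin⁺)
open import Data.Vec.Properties using (lookup∘tabulate; lookup⇒[]=)
open import Data.Product using (∃; ∃₂; _,_; proj₁; proj₂; map₂)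
open import Data.Sum using (_⊎_; inj₁; inj₂; [_,_]′)
open import Data.Unit using (tt)
open import Relation.Nullary using (¬_; yes; no; contradiction)
open import Relation.Nullary.Decidable using (_×-dec_; ¬?)
open import Relation.Unary using (Pred; Decidable)
open import Relation.Unary.Properties using (_∪?_)
open import Relation.Binary.Definitions using (tri<; tri≈; tri>)
open import Relation.Binary.PropositionalEquality
open import Relation.Binary.Construct.Closure.ReflexiveTransitive using (Star; ε; _◅_; _◅◅_; reverse)
open import Algebra.Properties.CommutativeSemigroup +-commutativeSemigroup using (x∙yz≈y∙xz)

count : {A : Set} {P : Pred A 0ℓ} → Decidable P → List A → ℕ
count P? xs = length (filter P? xs)

module _ {A : Set} {P : Pred A 0ℓ} (P? : Decidable P) where

  count-∷ : ∀ x xs → count P? xs ≤ count P? (x ∷ xs)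
  count-∷ x xs with P? x
  ... | yes _ = n≤1+n _
  ... | no _  = ≤-refl

  count≥1 : ∀ {x xs} → x ∈ₗ xs → P x → 1 ≤ count P? xs
  count≥1 {xs = y ∷ ys} x∈ px with P? y | x∈
  ... | yes _  | _          = s≤s z≤n
  ... | no ¬py | here refl  = contradiction px ¬py
  ... | no _   | there x∈ys = count≥1 x∈ys px

  count≥2 : ∀ {x y xs} → x ≢ y → x ∈ₗ xs → y ∈ₗ xs → P x → P y → 2 ≤ count P? xs
  count≥2 x≢y (here refl) (here refl) _ _ = contradiction refl x≢y
  count≥2 {x} x≢y (here refl) (there y∈) px py with P? x
  ... | yes _  = s≤s (count≥1 y∈ py)
  ... | no ¬px = contradiction px ¬px
  count≥2 {y = y} x≢y (there x∈) (here refl) px py with P? y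
  ... | yes _  = s≤s (count≥1 x∈ px)
  ... | no ¬py = contradiction py ¬py
  count≥2 {xs = z ∷ zs} x≢y (there x∈) (there y∈) px py =
    ≤-trans (count≥2 x≢y x∈ y∈ px py) (count-∷ z zs)

  count-witness : ∀ xs → 1 ≤ count P? xs → ∃ P
  count-witness (x ∷ xs) c with P? x
  ... | yes px = x , px
  ... | no _   = count-witness xs c

  count-none : ∀ {xs} → All (¬_ ∘ P) xs → count P? xs ≡ 0
  count-none none = cong length (filter-none P? none)

  count≤1 : ∀ {xs} → Unique xs → (∀ {x y} → P x → P y → x ≡ y) → count P? xs ≤ 1
  count≤1 [] _ = z≤n
  count≤1 {x ∷ xs} (x∉xs ∷ unique) subsingleton with P? x
  ... | no _   = count≤1 unique subsingleton
  ... | yes px = ≤-reflexive (cong suc (count-none (All.map (λ x≢y py → x≢y (subsingleton px py)) x∉xs)))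

module _ {A : Set} {P Q : Pred A 0ℓ} (P? : Decidable P) (Q? : Decidable Q) where

  count-mono : (∀ {x} → P x → Q x) → ∀ xs → count P? xs ≤ count Q? xs
  count-mono P⊆Q [] = z≤n
  count-mono P⊆Q (x ∷ xs) with P? x | Q? x
  ... | yes _ | yes _  = s≤s (count-mono P⊆Q xs)
  ... | yes p | no ¬q  = contradiction (P⊆Q p) ¬q
  ... | no _  | yes _  = m≤n⇒m≤1+n (count-mono P⊆Q xs)
  ... | no _  | no _   = count-mono P⊆Q xs

  count-mono-< : (∀ {x} → P x → Q x) → ∀ {y xs} → y ∈ₗ xs → Q y → ¬ P y → count P? xs < count Q? xs
  count-mono-< P⊆Q {xs = x ∷ xs} y∈ qy ¬py with P? x | Q? x | y∈
  ... | yes px | _      | here refl  = contradiction px ¬py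
  ... | no _   | yes _  | here refl  = s≤s (count-mono P⊆Q xs)
  ... | no _   | no ¬qx | here refl  = contradiction qy ¬qx
  ... | yes _  | yes _  | there y∈xs = s≤s (count-mono-< P⊆Q y∈xs qy ¬py)
  ... | yes px | no ¬qx | there _    = contradiction (P⊆Q px) ¬qx
  ... | no _   | yes _  | there y∈xs = m<n⇒m<1+n (count-mono-< P⊆Q y∈xs qy ¬py)
  ... | no _   | no _   | there y∈xs = count-mono-< P⊆Q y∈xs qy ¬py

  count-⊎ : ∀ xs → count (P? ∪? Q?) xs ≤ count P? xs + count Q? xs
  count-⊎ [] = z≤n
  count-⊎ (x ∷ xs) with P? x | Q? x
  ... | yes _ | yes _ = s≤s (≤-trans (count-⊎ xs) (+-monoʳ-≤ (count P? xs) (n≤1+n _)))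
  ... | yes _ | no _  = s≤s (count-⊎ xs)
  ... | no _  | yes _ = ≤-trans (s≤s (count-⊎ xs)) (≤-reflexive (sym (+-suc _ _)))
  ... | no _  | no _  = count-⊎ xs

sum-map-≤ : {J : Set} (f : J → ℕ) {b : ℕ} → (∀ j → f j ≤ b) → ∀ js → sum (map f js) ≤ length js * b
sum-map-≤ f f≤b [] = z≤n
sum-map-≤ f f≤b (j ∷ js) = +-mono-≤ (f≤b j) (sum-map-≤ f f≤b js)

length-cartesianProduct : {B C : Set} (xs : List B) (ys : List C) →
                          length (cartesianProduct xs ys) ≡ length xs * length ys
length-cartesianProduct [] ys = refl
length-cartesianProduct (x ∷ xs) ys = begin
  length (map (x ,_) ys ++ cartesianProduct xs ys)
    ≡⟨ length-++ (map (x ,_) ys) ⟩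
  length (map (x ,_) ys) + length (cartesianProduct xs ys)
    ≡⟨ cong₂ _+_ (length-map (x ,_) ys) (length-cartesianProduct xs ys) ⟩
  length ys + length xs * length ys
    ∎
  where open ≡-Reasoning

module _ {A J : Set} {R : J → Pred A 0ℓ} (R? : ∀ j → Decidable (R j)) where

  column : List A → J → ℕ
  column xs j = count (R? j) xs

  row : A → List J → ℕ
  row x js = count (λ j → R? j x) js

  sum-column-∷ : ∀ x xs js → sum (map (column (x ∷ xs)) js) ≡ row x js + sum (map (column xs) js)
  sum-column-∷ x xs [] = refl
  sum-column-∷ x xs (j ∷ js) with R? j x
  ... | yes _ = cong suc (trans (cong (column xs j +_) (sum-column-∷ x xs js))
                                (x∙yz≈y∙xz (column xs j) (row x js) (sum (map (column xs) js))))
  ... | no _  = trans (cong (column xs j +_) (sum-column-∷ x xs js))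
                      (x∙yz≈y∙xz (column xs j) (row x js) (sum (map (column xs) js)))

  double-counting : ∀ {P : Pred A 0ℓ} (P? : Decidable P) k js →
                    (∀ {x} → P x → k ≤ row x js) →
                    ∀ xs → k * count P? xs ≤ sum (map (column xs) js)
  double-counting P? k js covered [] = ≤-trans (≤-reflexive (*-zeroʳ k)) z≤n
  double-counting P? k js covered (x ∷ xs) = begin
    k * count P? (x ∷ xs)                 ≤⟨ first-row ⟩
    row x js + k * count P? xs            ≤⟨ +-monoʳ-≤ (row x js) (double-counting P? k js covered xs) ⟩
    row x js + sum (map (column xs) js)   ≡⟨ sum-column-∷ x xs js ⟨
    sum (map (column (x ∷ xs)) js)        ∎
    where
    open ≤-Reasoning
    first-row : k * count P? (x ∷ xs) ≤ row x js + k * count P? xs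
    first-row with P? x
    ... | yes px = ≤-trans (≤-reflexive (*-suc k _)) (+-monoˡ-≤ _ (covered px))
    ... | no _   = m≤n+m _ _

module _ {m : ℕ} {Q : Pred (Fin m) 0ℓ} (Q? : Decidable Q) where

  rank : Fin m → ℕ
  rank i = count (λ j → (toℕ j ≤? toℕ i) ×-dec Q? j) (allFin m)

  rank-pos : ∀ {i} → Q i → 1 ≤ rank i
  rank-pos {i} qi = count≥1 _ (∈-allFin i) (≤-refl , qi)

  rank≤count : ∀ i → rank i ≤ count Q? (allFin m)
  rank≤count i = count-mono _ Q? proj₂ (allFin m)

  rank-< : ∀ {i j} → toℕ i < toℕ j → Q j → rank i < rank j
  rank-< {i} {j} i<j qj = count-mono-< _ _ (λ (k≤i , qk) → ≤-trans k≤i (<⇒≤ i<j) , qk)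
                            (∈-allFin j) (≤-refl , qj) (λ (j≤i , _) → <⇒≱ i<j j≤i)

  rank-injective : ∀ {i j} → Q i → Q j → rank i ≡ rank j → i ≡ j
  rank-injective {i} {j} qi qj r≡ with <-cmp (toℕ i) (toℕ j)
  ... | tri< i<j _ _ = contradiction r≡ (<⇒≢ (rank-< i<j qj))
  ... | tri≈ _ i≡j _ = toℕ-injective i≡j
  ... | tri> _ _ j<i = contradiction (sym r≡) (<⇒≢ (rank-< j<i qi))

  InWindow : ℕ → ℕ → Pred (Fin m) 0ℓ
  InWindow a d i = Q i × a < rank i × rank i ≤ a + d

  in-window? : ∀ a d → Decidable (InWindow a d)
  in-window? a d i = Q? i ×-dec ((a <? rank i) ×-dec (rank i ≤? a + d))

  count-rank-window : ∀ a d → count (in-window? a d) (allFin m) ≤ d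
  count-rank-window a zero = ≤-reflexive (count-none (in-window? a 0) {allFin m} (All.tabulate λ _ → empty))
    where
    empty : ∀ {i} → ¬ InWindow a 0 i
    empty (_ , a<r , r≤a) = <⇒≱ a<r (≤-trans r≤a (≤-reflexive (+-identityʳ a)))
  count-rank-window a (suc d) = begin
    count (in-window? a (suc d)) (allFin m)                   ≤⟨ count-mono _ _ split (allFin m) ⟩
    count (in-window? a d ∪? at-top) (allFin m)                ≤⟨ count-⊎ (in-window? a d) at-top (allFin m) ⟩
    count (in-window? a d) (allFin m) + count at-top (allFin m) ≤⟨ +-mono-≤ (count-rank-window a d) top-unique ⟩
    d + 1                                                      ≡⟨ +-comm d 1 ⟩
    suc d                                                      ∎
    where
    open ≤-Reasoning
    AtTop : Pred (Fin m) 0ℓ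
    AtTop i = Q i × rank i ≡ a + suc d
    at-top : Decidable AtTop
    at-top i = Q? i ×-dec (rank i ≟ a + suc d)
    split : ∀ {i} → InWindow a (suc d) i → InWindow a d i ⊎ AtTop i
    split {i} (qi , a<r , r≤) with m≤n⇒m<n∨m≡n r≤
    ... | inj₁ r< = inj₁ (qi , a<r , ≤-pred (subst (rank i <_) (+-suc a d) r<))
    ... | inj₂ r≡ = inj₂ (qi , r≡)
    top-unique : count at-top (allFin m) ≤ 1
    top-unique = count≤1 at-top (allFin⁺ m) at-most-one
      where
      at-most-one : ∀ {i j} → AtTop i → AtTop j → i ≡ j
      at-most-one (qi , ri) (qj , rj) = rank-injective qi qj (trans ri (sym rj))

minimum-∈ : ∀ {y} xs → minimum xs ≡ just y → y ∈ₗ xs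
minimum-∈ (x ∷ xs) min≡ with minimum xs in eq
minimum-∈ (x ∷ xs) refl | nothing = here refl
minimum-∈ (x ∷ xs) refl | just z with ⊓-sel x z
... | inj₁ x⊓z≡x = here x⊓z≡x
... | inj₂ x⊓z≡z = there (subst (_∈ₗ xs) (sym x⊓z≡z) (minimum-∈ xs eq))

minimum-≤ : ∀ {x} xs → x ∈ₗ xs → ∃ λ y → minimum xs ≡ just y × y ≤ x
minimum-≤ (z ∷ zs) x∈ with minimum zs in eq | x∈
... | nothing | here refl  = z , refl , ≤-refl
... | nothing | there x∈zs with minimum-≤ zs x∈zs
...   | _ , min≡ , _ with () ← trans (sym eq) min≡
minimum-≤ (z ∷ zs) x∈ | just w | here refl = z ⊓ w , refl , m⊓n≤m z w
minimum-≤ {x} (z ∷ zs) x∈ | just w | there x∈zs with minimum-≤ zs x∈zs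
... | y , min≡ , y≤x = z ⊓ w , refl , ≤-trans (m⊓n≤n z w) (subst (_≤ x) (just-injective (trans (sym min≡) eq)) y≤x)

module _ {n m : ℕ} (E : Hypergraph n m) where

  distinct-in? : (t : Fin m) →
                 Decidable (λ (p : Fin n × Fin n) → proj₁ p ≢ proj₂ p × proj₁ p ∈ E t × proj₂ p ∈ E t)
  distinct-in? t p = ¬? (proj₁ p ≟ᶠ proj₂ p) ×-dec ((proj₁ p ∈? E t) ×-dec (proj₂ p ∈? E t))

  ∈-pairsIn⁻ : ∀ {t u v} → (u , v) ∈ₗ pairsIn E t → u ≢ v × u ∈ E t × v ∈ E t
  ∈-pairsIn⁻ {t} =
    proj₂ ∘ ∈-filter⁻ (distinct-in? t) {xs = concatMap (λ u → map (λ v → u , v) (allFin n)) (allFin n)}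

  ∈-pairsIn⁺ : ∀ {t u v} → u ≢ v → u ∈ E t → v ∈ E t → (u , v) ∈ₗ pairsIn E t
  ∈-pairsIn⁺ {t} {u} {v} u≢v u∈ v∈ =
    ∈-filter⁺ (distinct-in? t)
      (∈-concatMap⁺ (λ w → map (w ,_) (allFin n)) (Any.map (λ { refl → ∈-map⁺ (u ,_) (∈-allFin v) }) (∈-allFin u)))
      (u≢v , u∈ , v∈)

  eta-≤-pairCount : ∀ {t u v} → u ≢ v → u ∈ E t → v ∈ E t →
                    ∃ λ η → eta E t ≡ just η × η ≤ pairCount E t u v
  eta-≤-pairCount u≢v u∈ v∈ = minimum-≤ _ (∈-map⁺ _ (∈-pairsIn⁺ u≢v u∈ v∈))

  eta-attained : ∀ {t η} → eta E t ≡ just η →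
                 ∃₂ λ u v → (u ≢ v × u ∈ E t × v ∈ E t) × pairCount E t u v ≡ η
  eta-attained {t} eta≡ with ∈-map⁻ (λ (p : Fin n × Fin n) → pairCount E t (proj₁ p) (proj₂ p)) (minimum-∈ _ eta≡)
  ... | (u , v) , uv∈ , η≡ = u , v , ∈-pairsIn⁻ uv∈ , sym η≡

  Crosses : Subset n → Fin m → Set
  Crosses S i = Nonempty (E i ∩ S) × Nonempty (E i ∩ ∁ S)

  cut? : (F : Subset m) (S : Subset n) → Decidable (λ i → i ∈ F × Crosses S i)
  cut? F S i = (i ∈? F) ×-dec (nonempty? (E i ∩ S) ×-dec nonempty? (E i ∩ ∁ S))

  via-edge : ∀ {F i a c} → i ∈ F → a ∈ E i → c ∈ E i → Star (Adj E F) (inj₁ a) (inj₁ c)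
  via-edge {i = i} i∈F a∈e c∈e = _◅_ {j = inj₂ i} (i∈F , a∈e) ((i∈F , c∈e) ◅ ε)

  pairCount-swap : ∀ {t u v} → pairCount E t v u ≤ pairCount E t u v
  pairCount-swap {t} {u} {v} = count-mono (λ j → (toℕ j ≤? toℕ t) ×-dec ((v ∈? E j) ×-dec (u ∈? E j)))
                                          (λ j → (toℕ j ≤? toℕ t) ×-dec ((u ∈? E j) ×-dec (v ∈? E j)))
                                          (λ (j≤t , v∈ , u∈) → j≤t , u∈ , v∈) (allFin m)

  crossing-endpoints : ∀ {S i} → Crosses S i → ∃₂ λ a c → (a ∈ E i × a ∈ S) × (c ∈ E i × c ∉ S)
  crossing-endpoints {S} {i} ((a , a∈e∩S) , (c , c∈e∩∁S)) =
    a , c , x∈p∩q⁻ (E i) S a∈e∩S , map₂ x∈∁p⇒x∉p (x∈p∩q⁻ (E i) (∁ S) c∈e∩∁S)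

  path-crosses : ∀ {F S a b} → a ∈ S → b ∉ S → Star (Adj E F) (inj₁ a) (inj₁ b) → ∃ λ i → i ∈ F × Crosses S i
  path-crosses a∈S b∉S ε = contradiction a∈S b∉S
  path-crosses {S = S} {a} a∈S b∉S (_◅_ {j = inj₂ i} (i∈F , a∈e) (_◅_ {j = inj₁ c} (_ , c∈e) rest)) with c ∈? S
  ... | yes c∈S = path-crosses c∈S b∉S rest
  ... | no c∉S  = i , i∈F , (a , x∈p∩q⁺ (a∈e , a∈S)) , (c , x∈p∩q⁺ (c∈e , x∉p⇒x∈∁p c∉S))

  connected⇒cut-positive : ∀ {F S a b} → Connected E F → a ∈ S → b ∉ S → 1 ≤ cutSize E F S
  connected⇒cut-positive {F} {S} connected a∈S b∉S
    with path-crosses a∈S b∉S (connected (inj₁ _) (inj₁ _) tt tt)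
  ... | i , i∈F , crosses = count≥1 (cut? F S) (∈-allFin i) (i∈F , crosses)

  Adj-sym : ∀ {F x y} → Adj E F x y → Adj E F y x
  Adj-sym {x = inj₁ _} {inj₂ _} adj = adj
  Adj-sym {x = inj₂ _} {inj₁ _} adj = adj

  module _ {F : Subset m} (crossed : ∀ S → Nonempty S → Nonempty (∁ S) → ∃ λ i → i ∈ F × Crosses S i) where

    private
      Reaches : Fin n → Subset n → Set
      Reaches v₀ R = ∀ {w} → w ∈ R → Star (Adj E F) (inj₁ v₀) (inj₁ w)

      extend : ∀ {v₀} R → v₀ ∈ R → Nonempty (∁ R) → Reaches v₀ R →
               ∃ λ R′ → ∣ R ∣ < ∣ R′ ∣ × v₀ ∈ R′ × Reaches v₀ R′
      extend {v₀} R v₀∈R ∁R≠∅ reaches with crossed R (v₀ , v₀∈R) ∁R≠∅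
      ... | i , i∈F , crosses with crossing-endpoints crosses
      ... | a , c , (a∈e , a∈R) , (c∈e , c∉R) =
        R ∪ ⁅ c ⁆ , p⊂q⇒∣p∣<∣q∣ (p⊆p∪q ⁅ c ⁆ , c , x∈p∪q⁺ (inj₂ (x∈⁅x⁆ c)) , c∉R) ,
        x∈p∪q⁺ (inj₁ v₀∈R) , reaches′
        where
        reaches′ : Reaches v₀ (R ∪ ⁅ c ⁆)
        reaches′ w∈ with x∈p∪q⁻ R ⁅ c ⁆ w∈
        ... | inj₁ w∈R = reaches w∈R
        ... | inj₂ w∈c rewrite x∈⁅y⁆⇒x≡y c w∈c = reaches a∈R ◅◅ via-edge i∈F a∈e c∈e

      grow : ∀ {v₀} d R → n ≤ d + ∣ R ∣ → v₀ ∈ R → Reaches v₀ R → Reaches v₀ ⊤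
      grow d R bound v₀∈R reaches {w} _ with nonempty? (∁ R)
      ... | no ∁R≡∅ = reaches (x∉∁p⇒x∈p λ w∈∁R → ∁R≡∅ (w , w∈∁R))
      ... | yes ∁R≠∅ with extend R v₀∈R ∁R≠∅ reaches | d
      ...   | R′ , grew , _ , _ | zero = contradiction (≤-trans (s≤s bound) (≤-trans grew (∣p∣≤n R′))) (n≮n n)
      ...   | R′ , grew , v₀∈R′ , reaches′ | suc d′ =
        grow d′ R′ (≤-trans bound (≤-trans (≤-reflexive (sym (+-suc d′ ∣ R ∣))) (+-monoʳ-≤ d′ grew)))
             v₀∈R′ reaches′ ∈⊤

    crossings⇒connected : NonemptyEdges E → Connected E F
    crossings⇒connected nonempty x y x∈F y∈F =
      reverse Adj-sym (from-anchor x x∈F) ◅◅ from-anchor y y∈F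
      where
      anchor : Fin n
      anchor = [ id , proj₁ ∘ nonempty ]′ x
      reaches-all : Reaches anchor ⊤
      reaches-all = grow n ⁅ anchor ⁆ (m≤m+n n _) (x∈⁅x⁆ anchor)
                      λ w∈ → subst (Star _ _ ∘ inj₁) (sym (x∈⁅y⁆⇒x≡y anchor w∈)) ε
      from-anchor : ∀ z → IsNode F z → Star (Adj E F) (inj₁ anchor) z
      from-anchor (inj₁ w) _   = reaches-all ∈⊤
      from-anchor (inj₂ i) i∈F = reaches-all ∈⊤ ◅◅ ((i∈F , proj₂ (nonempty i)) ◅ ε)

*<⇒≤∸1/ : ∀ {c x l} .{{_ : NonZero c}} → c * x < l → x ≤ (l ∸ 1) / c
*<⇒≤∸1/ {c} {x} {l} cx<l = begin
  x                ≡⟨ m*n/n≡m x c ⟨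
  x * c / c        ≤⟨ /-monoˡ-≤ c (subst (_≤ l ∸ 1) (*-comm c x) (∸-monoˡ-≤ 1 cx<l)) ⟩
  (l ∸ 1) / c      ∎
  where open ≤-Reasoning

m≤n+o⇒2o<m⇒m<2n : ∀ {m n o} → m ≤ n + o → 2 * o < m → m < 2 * n
m≤n+o⇒2o<m⇒m<2n {m} {n} {o} m≤n+o 2o<m = +-cancelʳ-< m m (2 * n) (begin-strict
  m + m            ≡⟨ cong (m +_) (+-identityʳ m) ⟨
  2 * m            ≤⟨ *-monoʳ-≤ 2 m≤n+o ⟩
  2 * (n + o)      ≡⟨ *-distribˡ-+ 2 n o ⟩
  2 * n + 2 * o    <⟨ +-monoʳ-< (2 * n) 2o<m ⟩
  2 * n + m        ∎)
  where open ≤-Reasoning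

module GoodEdges {n m : ℕ} .{{_ : NonZero n}} (E : Hypergraph n m) (L : ℕ) where

  private instance
    n*n≢0 : NonZero (n * n)
    n*n≢0 = m*n≢0 n n

  good-intro : ∀ {i η} → eta E i ≡ just η → L ≤ n * n * η → η ≤ L → i ∈ Egood E L
  good-intro {i} eta≡ L≤ η≤ =
    lookup⇒[]= i (Egood E L) (trans (lookup∘tabulate _ i) (cong (λ b → if b then inside else outside) good))
    where
    good : isGood E L i ≡ true
    good rewrite eta≡ = Equivalence.to T-≡ (Equivalence.from T-∧ (≤⇒≤ᵇ L≤ , ≤⇒≤ᵇ η≤))

  Low : Pred (Fin m) 0ℓ
  Low i = Maybe.Any (λ η → n * n * η < L) (eta E i)

  low? : Decidable Low
  low? i = Maybe.dec (λ η → n * n * η <? L) (eta E i)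

  -- pairCount E t u v is, by definition, rank (contains? u v) t.
  contains? : (u v : Fin n) → Decidable (λ i → u ∈ E i × v ∈ E i)
  contains? u v i = (u ∈? E i) ×-dec (v ∈? E i)

  LowFor : Fin n × Fin n → Pred (Fin m) 0ℓ
  LowFor (u , v) i = (u ∈ E i × v ∈ E i) × n * n * pairCount E i u v < L

  low-for? : ∀ p → Decidable (LowFor p)
  low-for? (u , v) i = contains? u v i ×-dec (n * n * pairCount E i u v <? L)

  count-low-for : ∀ p → count (low-for? p) (allFin m) ≤ (L ∸ 1) / (n * n)
  count-low-for (u , v) = ≤-trans (count-mono (low-for? (u , v)) (in-window? (contains? u v) 0 _) in-window (allFin m))
                                  (count-rank-window (contains? u v) 0 _)
    where
    in-window : ∀ {i} → LowFor (u , v) i → InWindow (contains? u v) 0 ((L ∸ 1) / (n * n)) i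
    in-window (both , small) = both , rank-pos (contains? u v) both , *<⇒≤∸1/ {n * n} small

  pairs : List (Fin n × Fin n)
  pairs = cartesianProduct (allFin n) (allFin n)

  low-covered : ∀ {i} → Low i → 2 ≤ row low-for? i pairs
  low-covered {i} low with eta E i in eta≡ | low
  ... | just η | just small with eta-attained E eta≡
  ...   | u , v , (u≢v , u∈ , v∈) , pc≡η =
    count≥2 (λ p → low-for? p i) (u≢v ∘ cong proj₁)
      (∈-cartesianProduct⁺ (∈-allFin u) (∈-allFin v)) (∈-cartesianProduct⁺ (∈-allFin v) (∈-allFin u))
      ((u∈ , v∈) , uv-small) ((v∈ , u∈) , ≤-<-trans (*-monoʳ-≤ (n * n) (pairCount-swap E)) uv-small)
    where
    uv-small : n * n * pairCount E i u v < L
    uv-small = subst (λ c → n * n * c < L) (sym pc≡η) small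

  2*count-low≤ : 2 * count low? (allFin m) ≤ L ∸ 1
  2*count-low≤ = begin
    2 * count low? (allFin m)                        ≤⟨ double-counting low-for? low? 2 pairs low-covered (allFin m) ⟩
    sum (map (column low-for? (allFin m)) pairs)     ≤⟨ sum-map-≤ _ count-low-for pairs ⟩
    length pairs * ((L ∸ 1) / (n * n))               ≡⟨ cong (_* ((L ∸ 1) / (n * n))) length-pairs ⟩
    n * n * ((L ∸ 1) / (n * n))                      ≡⟨ *-comm (n * n) _ ⟩
    (L ∸ 1) / (n * n) * (n * n)                      ≤⟨ m/n*n≤m (L ∸ 1) (n * n) ⟩
    L ∸ 1                                            ∎
    where
    open ≤-Reasoning
    length-pairs : length pairs ≡ n * n
    length-pairs = trans (length-cartesianProduct (allFin n) (allFin n))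
                         (cong₂ _*_ (length-tabulate {n = n} (λ i → i)) (length-tabulate {n = n} (λ i → i)))

  2*count-low<L : 1 ≤ L → 2 * count low? (allFin m) < L
  2*count-low<L 1≤L = ≤-trans (s≤s 2*count-low≤) (≤-reflexive (m+[n∸m]≡n 1≤L))

  module _ (S : Subset n) where

    High : Pred (Fin m) 0ℓ
    High i = (i ∈ ⊤ × Crosses E S i) × L < rank (cut? E ⊤ S) i

    high? : Decidable High
    high? i = cut? E ⊤ S i ×-dec (L <? rank (cut? E ⊤ S) i)

    count-high : L ≤ cutSize E ⊤ S → count high? (allFin m) ≤ cutSize E ⊤ S ∸ L
    count-high L≤N = ≤-trans (count-mono high? (in-window? (cut? E ⊤ S) L (N ∸ L)) in-window (allFin m))
                             (count-rank-window (cut? E ⊤ S) L (N ∸ L))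
      where
      N = cutSize E ⊤ S
      in-window : ∀ {i} → High i → InWindow (cut? E ⊤ S) L (N ∸ L) i
      in-window {i} (q , L<r) = q , L<r , subst (rank (cut? E ⊤ S) i ≤_) (sym (m+[n∸m]≡n L≤N)) (rank≤count _ i)

    pairCount≤rank : ∀ {i a c} → a ∈ S → c ∉ S → pairCount E i a c ≤ rank (cut? E ⊤ S) i
    pairCount≤rank {i} {a} {c} a∈S c∉S = count-mono _ _ crosses (allFin m)
      where
      crosses : ∀ {j} → toℕ j ≤ toℕ i × a ∈ E j × c ∈ E j → toℕ j ≤ toℕ i × j ∈ ⊤ × Crosses E S j
      crosses (j≤i , a∈ , c∈) = j≤i , ∈⊤ , (a , x∈p∩q⁺ (a∈ , a∈S)) , (c , x∈p∩q⁺ (c∈ , x∉p⇒x∈∁p c∉S))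

    bad-crossing : ∀ {i} → Crosses E S i → i ∉ Egood E L → High i ⊎ Low i
    bad-crossing {i} crosses i∉good with crossing-endpoints E crosses
    ... | a , c , (a∈e , a∈S) , (c∈e , c∉S) with eta-≤-pairCount E (λ { refl → c∉S a∈S }) a∈e c∈e
    ... | η , eta≡ , η≤pc with L ≤? n * n * η | η ≤? L
    ... | no L≰  | _      = inj₂ (subst (Maybe.Any _) (sym eta≡) (just (≰⇒> L≰)))
    ... | yes L≤ | yes η≤ = contradiction (good-intro eta≡ L≤ η≤) i∉good
    ... | yes _  | no η≰  =
      inj₁ ((∈⊤ , crosses) , <-≤-trans (≰⇒> η≰) (≤-trans η≤pc (pairCount≤rank a∈S c∉S)))

    cut-good-bound : L ≤ cutSize E ⊤ S → L ≤ cutSize E (Egood E L) S + count low? (allFin m)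
    cut-good-bound L≤N = +-cancelʳ-≤ (N ∸ L) L (G + lo) (begin
      L + (N ∸ L)                                    ≡⟨ m+[n∸m]≡n L≤N ⟩
      N                                              ≤⟨ count-mono _ (good? ∪? (high? ∪? low?)) classify (allFin m) ⟩
      count (good? ∪? (high? ∪? low?)) (allFin m)    ≤⟨ count-⊎ good? (high? ∪? low?) (allFin m) ⟩
      G + count (high? ∪? low?) (allFin m)           ≤⟨ +-monoʳ-≤ G (count-⊎ high? low? (allFin m)) ⟩
      G + (count high? (allFin m) + lo)              ≤⟨ +-monoʳ-≤ G (+-monoˡ-≤ lo (count-high L≤N)) ⟩
      G + ((N ∸ L) + lo)                             ≡⟨ cong (G +_) (+-comm (N ∸ L) lo) ⟩
      G + (lo + (N ∸ L))                             ≡⟨ +-assoc G lo (N ∸ L) ⟨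
      G + lo + (N ∸ L)                               ∎)
      where
      open ≤-Reasoning
      N = cutSize E ⊤ S
      G = cutSize E (Egood E L) S
      lo = count low? (allFin m)
      good? = cut? E (Egood E L) S
      classify : ∀ {i} → i ∈ ⊤ × Crosses E S i → (i ∈ Egood E L × Crosses E S i) ⊎ (High i ⊎ Low i)
      classify {i} (_ , crosses) with i ∈? Egood E L
      ... | yes good = inj₁ (good , crosses)
      ... | no bad   = inj₂ (bad-crossing crosses bad)

    good-cut : 1 ≤ L → L ≤ cutSize E ⊤ S → L < 2 * cutSize E (Egood E L) S
    good-cut 1≤L L≤N = m≤n+o⇒2o<m⇒m<2n {o = count low? (allFin m)} (cut-good-bound L≤N) (2*count-low<L 1≤L)

lemma5p3 : (n m : ℕ) (E : Hypergraph n m) → NonemptyEdges E → Connected E ⊤ →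
    (Σ ℕ λ k → HasDisjointCSS E k × LogSqBound n k) →
    (L : ℕ) → IsLambda E ⊤ L →
    Connected E (Egood E L) ×
    ((L′ : ℕ) → IsLambda E (Egood E L) L′ → L ≤ 2 * L′)
lemma5p3 zero _ _ _ _ _ _ ((_ , (() , _) , _) , _)
lemma5p3 (suc _) m E nonempty connected _ L ((S₀ , (a , a∈S₀) , (b , b∈∁S₀) , cut₀≡L) , L-minimal) =
  crossings⇒connected E crossed nonempty ,
  λ { L′ ((S , S≠∅ , ∁S≠∅ , cut≡L′) , _) →
        <⇒≤ (subst (λ c → L < 2 * c) cut≡L′ (good-cut′ S≠∅ ∁S≠∅)) }
  where
  open GoodEdges E L
  1≤L : 1 ≤ L
  1≤L = subst (1 ≤_) cut₀≡L (connected⇒cut-positive E connected a∈S₀ (x∈∁p⇒x∉p b∈∁S₀))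
  good-cut′ : ∀ {S} → Nonempty S → Nonempty (∁ S) → L < 2 * cutSize E (Egood E L) S
  good-cut′ {S} S≠∅ ∁S≠∅ = good-cut S 1≤L (L-minimal S S≠∅ ∁S≠∅)
  positive : ∀ {c} → L < 2 * c → 1 ≤ c
  positive {suc _} _ = s≤s z≤n
  crossed : ∀ S → Nonempty S → Nonempty (∁ S) → ∃ λ i → i ∈ Egood E L × Crosses E S i
  crossed S S≠∅ ∁S≠∅ = count-witness (cut? E (Egood E L) S) (allFin m) (positive (good-cut′ S≠∅ ∁S≠∅))
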